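{- In a proof of PCMLL, every $k$-extended-redex $S_0,\dots,S_k$ such that one of the rules concluding $S_0,\dots,S_{k-1}$ is an implicative elimination ($\backslash_e$, $/_e$ or $\multimap_e$) contains (as a sub-path) a $k'$-extended-redex with $k'<k$.
   Context: PCMLL (de Groote's partially commutative intuitionistic multiplicative linear logic) in natural deduction, sequent style. Formulas: propositional variables with $\otimes$, $\odot$, $\multimap$, $\backslash$, $/$. Contexts: finite multisets of formula occurrences with series–parallel partial orders written with $(\Gamma,\Delta)$ (disjoint union, no order between parts) and $\langle\Gamma;\Delta\rangle$ (all of $\Gamma$ before all of $\Delta$); $\Gamma[\Delta]$ denotes filling a hole. Rules: axiom $A\vdash A$; $\backslash_e$: $\Gamma\vdash A$, $\Delta\vdash A\backslash C$ give $\langle\Gamma;\Delta\rangle\vdash C$; $/_e$: $\Delta\vdash C/A$, $\Gamma\vdash A$ give $\langle\Delta;\Gamma\rangle\vdash C$; $\multimap_e$: $\Gamma\vdash A$, $\Delta\vdash A\multimap C$ give $(\Gamma,\Delta)\vdash C$; $\backslash_i$: $\langle A;\Gamma\rangle\vdash C$ gives $\Gamma\vdash A\backslash C$; $/_i$: $\langle\Gamma;A\rangle\vdash C$ gives $\Gamma\vdash C/A$; $\multimap_i$: $(A,\Gamma)\vdash C$ gives $\Gamma\vdash A\multimap C$; $\odot_i$: $\Delta\vdash A$, $\Gamma\vdash B$ give $\langle\Delta;\Gamma\rangle\vdash A\odot B$; $\otimes_i$: same giving $(\Delta,\Gamma)\vdash A\otimes B$; $\odot_e$: $\Delta\vdash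 A\odot B$ and $\Gamma[\langle A;B\rangle]\vdash C$ give $\Gamma[\Delta]\vdash C$; $\otimes_e$: $\Delta\vdash A\otimes B$ and $\Gamma[(A,B)]\vdash C$ give $\Gamma[\Delta]\vdash C$ ($A,B$ equivalent in the order, $A<B$ for $\odot_e$, incomparable for $\otimes_e$); entropy: $\Gamma\vdash C$ gives $\Gamma'\vdash C$ whenever $\Gamma'$ has the same multiset as $\Gamma$ and its order is included in that of $\Gamma$. Principal branch $B(S_0)$: smallest set containing $S_0$ such that for $S\in B(S_0)$: if concluded by a unary rule its premise is in it; if by a product elimination, the premise $\Gamma[\langle A;B\rangle]\vdash C$ (resp. $\Gamma[(A,B)]\vdash C$) is in it; if by an implication elimination, the premise carrying the implication is in it. A $k$-extended-redex: for an elimination rule with major premise $S_0$ (premise whose right-hand formula has the eliminated connective as main connective), a path $S_0,\dots,S_k$ in $B(S_0)$ (each $S_{i+1}$ the premise in $B(S_0)$ of the rule concluding $S_i$) with $S_k$ the conclusion of an introduction rule and $S_0,S_k$ having the same right-hand formula. -}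

module Defs where

open import Data.Nat using (ℕ; suc; _<_; _+_)
open import Data.Product using (Σ; _×_; _,_; proj₁; proj₂)
open import Relation.Binary.PropositionalEquality using (_≡_)
open import Function.Bundles using (_↔_; Inverse)

infixr 6 _⊗_ _⊙_
infixr 5 _⊸_ _⧵_
infixl 5 _╱_

data Formula : Set where
  var  : ℕ → Formula
  _⊗_  : Formula → Formula → Formula   -- commutative product
  _⊙_  : Formula → Formula → Formula   -- non-commutative product
  _⊸_  : Formula → Formula → Formula
  _⧵_  : Formula → Formula → Formula
  _╱_  : Formula → Formula → Formula

-- Contexts: series-parallel terms, interpreted as partially ordered
-- multisets of formula occurrences.

data Ctx : Set where
  ∅     : Ctx
  ⌜_⌝   : Formula → Ctx
  _,,_  : Ctx → Ctx → Ctx     -- (Γ , Δ): parallel composition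
  ⟨_⨾_⟩ : Ctx → Ctx → Ctx     -- ⟨Γ ; Δ⟩: series composition

data Occ : Ctx → Set where
  leaf : ∀ {A} → Occ ⌜ A ⌝
  pl   : ∀ {Γ Δ} → Occ Γ → Occ (Γ ,, Δ)
  pr   : ∀ {Γ Δ} → Occ Δ → Occ (Γ ,, Δ)
  sl   : ∀ {Γ Δ} → Occ Γ → Occ ⟨ Γ ⨾ Δ ⟩
  sr   : ∀ {Γ Δ} → Occ Δ → Occ ⟨ Γ ⨾ Δ ⟩

label : ∀ {Γ} → Occ Γ → Formula
label (leaf {A}) = A
label (pl x) = label x
label (pr x) = label x
label (sl x) = label x
label (sr x) = label x

data _≺_ : ∀ {Γ} → Occ Γ → Occ Γ → Set where
  pl≺   : ∀ {Γ Δ} {x y : Occ Γ} → x ≺ y → pl {Γ} {Δ} x ≺ pl y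
  pr≺   : ∀ {Γ Δ} {x y : Occ Δ} → x ≺ y → pr {Γ} {Δ} x ≺ pr y
  sl≺   : ∀ {Γ Δ} {x y : Occ Γ} → x ≺ y → sl {Γ} {Δ} x ≺ sl y
  sr≺   : ∀ {Γ Δ} {x y : Occ Δ} → x ≺ y → sr {Γ} {Δ} x ≺ sr y
  sl≺sr : ∀ {Γ Δ} {x : Occ Γ} {y : Occ Δ} → sl x ≺ sr y

-- Isomorphism of contexts (same labelled partial order): contexts are
-- considered up to this, as in the paper (they are posets, not terms).
record _≅_ (Γ Δ : Ctx) : Set where
  field
    bij   : Occ Γ ↔ Occ Δ
    lab   : ∀ x → label (Inverse.to bij x) ≡ label x
    ord   : ∀ x y → x ≺ y → Inverse.to bij x ≺ Inverse.to bij y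
    ord⁻¹ : ∀ x y → Inverse.to bij x ≺ Inverse.to bij y → x ≺ y

-- Γ' ⊑ Γ : Γ' has the same multiset as Γ and its order is included in
-- that of Γ (side condition of the entropy rule).
record _⊑_ (Γ' Γ : Ctx) : Set where
  field
    bij : Occ Γ' ↔ Occ Γ
    lab : ∀ x → label (Inverse.to bij x) ≡ label x
    ord : ∀ x y → x ≺ y → Inverse.to bij x ≺ Inverse.to bij y

data HCtx : Set where
  [-]    : HCtx
  _,,ₗ_  : HCtx → Ctx → HCtx
  _,,ᵣ_  : Ctx → HCtx → HCtx
  ⟨_⨾ₗ_⟩ : HCtx → Ctx → HCtx
  ⟨_⨾ᵣ_⟩ : Ctx → HCtx → HCtx

_[_] : HCtx → Ctx → Ctx
[-] [ Δ ] = Δ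
(Γ ,,ₗ Θ) [ Δ ] = (Γ [ Δ ]) ,, Θ
(Θ ,,ᵣ Γ) [ Δ ] = Θ ,, (Γ [ Δ ])
⟨ Γ ⨾ₗ Θ ⟩ [ Δ ] = ⟨ Γ [ Δ ] ⨾ Θ ⟩
⟨ Θ ⨾ᵣ Γ ⟩ [ Δ ] = ⟨ Θ ⨾ Γ [ Δ ] ⟩

-- Natural deduction proofs of PCMLL.  Every context appearing in a
-- rule is taken up to isomorphism (the Θ ≅ … arguments), since contexts
-- are partially ordered multisets.

data Deriv : Ctx → Formula → Set where
  ax  : ∀ {Θ A} → Θ ≅ ⌜ A ⌝ → Deriv Θ A
  ⧵e  : ∀ {Γ Δ Θ A C} → Deriv Γ A → Deriv Δ (A ⧵ C) → Θ ≅ ⟨ Γ ⨾ Δ ⟩ → Deriv Θ C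
  ╱e  : ∀ {Γ Δ Θ A C} → Deriv Δ (C ╱ A) → Deriv Γ A → Θ ≅ ⟨ Δ ⨾ Γ ⟩ → Deriv Θ C
  ⊸e  : ∀ {Γ Δ Θ A C} → Deriv Γ A → Deriv Δ (A ⊸ C) → Θ ≅ (Γ ,, Δ) → Deriv Θ C
  ⧵i  : ∀ {Γ Θ A C} → Θ ≅ ⟨ ⌜ A ⌝ ⨾ Γ ⟩ → Deriv Θ C → Deriv Γ (A ⧵ C)
  ╱i  : ∀ {Γ Θ A C} → Θ ≅ ⟨ Γ ⨾ ⌜ A ⌝ ⟩ → Deriv Θ C → Deriv Γ (C ╱ A)
  ⊸i  : ∀ {Γ Θ A C} → Θ ≅ (⌜ A ⌝ ,, Γ) → Deriv Θ C → Deriv Γ (A ⊸ C)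
  ⊙i  : ∀ {Γ Δ Θ A B} → Deriv Δ A → Deriv Γ B → Θ ≅ ⟨ Δ ⨾ Γ ⟩ → Deriv Θ (A ⊙ B)
  ⊗i  : ∀ {Γ Δ Θ A B} → Deriv Δ A → Deriv Γ B → Θ ≅ (Δ ,, Γ) → Deriv Θ (A ⊗ B)
  ⊙e  : ∀ {Δ Θ Ξ A B C} (Γ : HCtx) → Deriv Δ (A ⊙ B) → Deriv Θ C →
        Θ ≅ (Γ [ ⟨ ⌜ A ⌝ ⨾ ⌜ B ⌝ ⟩ ]) → Ξ ≅ (Γ [ Δ ]) → Deriv Ξ C
  ⊗e  : ∀ {Δ Θ Ξ A B C} (Γ : HCtx) → Deriv Δ (A ⊗ B) → Deriv Θ C →
        Θ ≅ (Γ [ ⌜ A ⌝ ,, ⌜ B ⌝ ]) → Ξ ≅ (Γ [ Δ ]) → Deriv Ξ C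
  ent : ∀ {Γ Γ' C} → Deriv Γ C → Γ' ⊑ Γ → Deriv Γ' C

SDeriv : Set
SDeriv = Σ Ctx λ Γ → Σ Formula λ C → Deriv Γ C

rhs : SDeriv → Formula
rhs (_ , C , _) = C

data Prem : ∀ {Γ C} → Deriv Γ C → Set where
  ⧵e-arg : ∀ {Γ Δ Θ A C} {d₁ : Deriv Γ A} {d₂ : Deriv Δ (A ⧵ C)} {φ : Θ ≅ ⟨ Γ ⨾ Δ ⟩} → Prem (⧵e d₁ d₂ φ)
  ⧵e-fun : ∀ {Γ Δ Θ A C} {d₁ : Deriv Γ A} {d₂ : Deriv Δ (A ⧵ C)} {φ : Θ ≅ ⟨ Γ ⨾ Δ ⟩} → Prem (⧵e d₁ d₂ φ)
  ╱e-fun : ∀ {Γ Δ Θ A C} {d₁ : Deriv Δ (C ╱ A)} {d₂ : Deriv Γ A} {φ : Θ ≅ ⟨ Δ ⨾ Γ ⟩} → Prem (╱e d₁ d₂ φ)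
  ╱e-arg : ∀ {Γ Δ Θ A C} {d₁ : Deriv Δ (C ╱ A)} {d₂ : Deriv Γ A} {φ : Θ ≅ ⟨ Δ ⨾ Γ ⟩} → Prem (╱e d₁ d₂ φ)
  ⊸e-arg : ∀ {Γ Δ Θ A C} {d₁ : Deriv Γ A} {d₂ : Deriv Δ (A ⊸ C)} {φ : Θ ≅ (Γ ,, Δ)} → Prem (⊸e d₁ d₂ φ)
  ⊸e-fun : ∀ {Γ Δ Θ A C} {d₁ : Deriv Γ A} {d₂ : Deriv Δ (A ⊸ C)} {φ : Θ ≅ (Γ ,, Δ)} → Prem (⊸e d₁ d₂ φ)
  ⧵i-p   : ∀ {Γ Θ A C} {φ : Θ ≅ ⟨ ⌜ A ⌝ ⨾ Γ ⟩} {d : Deriv Θ C} → Prem (⧵i φ d)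
  ╱i-p   : ∀ {Γ Θ A C} {φ : Θ ≅ ⟨ Γ ⨾ ⌜ A ⌝ ⟩} {d : Deriv Θ C} → Prem (╱i φ d)
  ⊸i-p   : ∀ {Γ Θ A C} {φ : Θ ≅ (⌜ A ⌝ ,, Γ)} {d : Deriv Θ C} → Prem (⊸i φ d)
  ⊙i-l   : ∀ {Γ Δ Θ A B} {d₁ : Deriv Δ A} {d₂ : Deriv Γ B} {φ : Θ ≅ ⟨ Δ ⨾ Γ ⟩} → Prem (⊙i d₁ d₂ φ)
  ⊙i-r   : ∀ {Γ Δ Θ A B} {d₁ : Deriv Δ A} {d₂ : Deriv Γ B} {φ : Θ ≅ ⟨ Δ ⨾ Γ ⟩} → Prem (⊙i d₁ d₂ φ)
  ⊗i-l   : ∀ {Γ Δ Θ A B} {d₁ : Deriv Δ A} {d₂ : Deriv Γ B} {φ : Θ ≅ (Δ ,, Γ)} → Prem (⊗i d₁ d₂ φ)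
  ⊗i-r   : ∀ {Γ Δ Θ A B} {d₁ : Deriv Δ A} {d₂ : Deriv Γ B} {φ : Θ ≅ (Δ ,, Γ)} → Prem (⊗i d₁ d₂ φ)
  ⊙e-maj : ∀ {Δ Θ Ξ A B C} {Γ : HCtx} {d₁ : Deriv Δ (A ⊙ B)} {d₂ : Deriv Θ C}
             {φ : Θ ≅ (Γ [ ⟨ ⌜ A ⌝ ⨾ ⌜ B ⌝ ⟩ ])} {ψ : Ξ ≅ (Γ [ Δ ])} → Prem (⊙e Γ d₁ d₂ φ ψ)
  ⊙e-min : ∀ {Δ Θ Ξ A B C} {Γ : HCtx} {d₁ : Deriv Δ (A ⊙ B)} {d₂ : Deriv Θ C}
             {φ : Θ ≅ (Γ [ ⟨ ⌜ A ⌝ ⨾ ⌜ B ⌝ ⟩ ])} {ψ : Ξ ≅ (Γ [ Δ ])} → Prem (⊙e Γ d₁ d₂ φ ψ)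
  ⊗e-maj : ∀ {Δ Θ Ξ A B C} {Γ : HCtx} {d₁ : Deriv Δ (A ⊗ B)} {d₂ : Deriv Θ C}
             {φ : Θ ≅ (Γ [ ⌜ A ⌝ ,, ⌜ B ⌝ ])} {ψ : Ξ ≅ (Γ [ Δ ])} → Prem (⊗e Γ d₁ d₂ φ ψ)
  ⊗e-min : ∀ {Δ Θ Ξ A B C} {Γ : HCtx} {d₁ : Deriv Δ (A ⊗ B)} {d₂ : Deriv Θ C}
             {φ : Θ ≅ (Γ [ ⌜ A ⌝ ,, ⌜ B ⌝ ])} {ψ : Ξ ≅ (Γ [ Δ ])} → Prem (⊗e Γ d₁ d₂ φ ψ)
  ent-p  : ∀ {Γ Γ' C} {d : Deriv Γ C} {φ : Γ' ⊑ Γ} → Prem (ent d φ)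

premD : ∀ {Γ C} {d : Deriv Γ C} → Prem d → SDeriv
premD (⧵e-arg {d₁ = d₁}) = _ , _ , d₁
premD (⧵e-fun {d₂ = d₂}) = _ , _ , d₂
premD (╱e-fun {d₁ = d₁}) = _ , _ , d₁
premD (╱e-arg {d₂ = d₂}) = _ , _ , d₂
premD (⊸e-arg {d₁ = d₁}) = _ , _ , d₁
premD (⊸e-fun {d₂ = d₂}) = _ , _ , d₂
premD (⧵i-p {d = d}) = _ , _ , d
premD (╱i-p {d = d}) = _ , _ , d
premD (⊸i-p {d = d}) = _ , _ , d
premD (⊙i-l {d₁ = d₁}) = _ , _ , d₁
premD (⊙i-r {d₂ = d₂}) = _ , _ , d₂
premD (⊗i-l {d₁ = d₁}) = _ , _ , d₁
premD (⊗i-r {d₂ = d₂}) = _ , _ , d₂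
premD (⊙e-maj {d₁ = d₁}) = _ , _ , d₁
premD (⊙e-min {d₂ = d₂}) = _ , _ , d₂
premD (⊗e-maj {d₁ = d₁}) = _ , _ , d₁
premD (⊗e-min {d₂ = d₂}) = _ , _ , d₂
premD (ent-p {d = d}) = _ , _ , d

-- the premise that belongs to the principal branch (definition of B(S₀)):
-- premise of a unary rule, premise Γ[⟨A;B⟩] ⊢ C / Γ[(A,B)] ⊢ C of a
-- product elimination, premise carrying the implication of an
-- implication elimination.
data InBranch : ∀ {Γ C} {d : Deriv Γ C} → Prem d → Set where
  b-⧵e : ∀ {Γ Δ Θ A C} {d₁ : Deriv Γ A} {d₂ : Deriv Δ (A ⧵ C)} {φ : Θ ≅ ⟨ Γ ⨾ Δ ⟩} → InBranch (⧵e-fun {d₁ = d₁} {d₂} {φ})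
  b-╱e : ∀ {Γ Δ Θ A C} {d₁ : Deriv Δ (C ╱ A)} {d₂ : Deriv Γ A} {φ : Θ ≅ ⟨ Δ ⨾ Γ ⟩} → InBranch (╱e-fun {d₁ = d₁} {d₂} {φ})
  b-⊸e : ∀ {Γ Δ Θ A C} {d₁ : Deriv Γ A} {d₂ : Deriv Δ (A ⊸ C)} {φ : Θ ≅ (Γ ,, Δ)} → InBranch (⊸e-fun {d₁ = d₁} {d₂} {φ})
  b-⧵i : ∀ {Γ Θ A C} {φ : Θ ≅ ⟨ ⌜ A ⌝ ⨾ Γ ⟩} {d : Deriv Θ C} → InBranch (⧵i-p {φ = φ} {d})
  b-╱i : ∀ {Γ Θ A C} {φ : Θ ≅ ⟨ Γ ⨾ ⌜ A ⌝ ⟩} {d : Deriv Θ C} → InBranch (╱i-p {φ = φ} {d})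
  b-⊸i : ∀ {Γ Θ A C} {φ : Θ ≅ (⌜ A ⌝ ,, Γ)} {d : Deriv Θ C} → InBranch (⊸i-p {φ = φ} {d})
  b-⊙e : ∀ {Δ Θ Ξ A B C} {Γ : HCtx} {d₁ : Deriv Δ (A ⊙ B)} {d₂ : Deriv Θ C}
           {φ : Θ ≅ (Γ [ ⟨ ⌜ A ⌝ ⨾ ⌜ B ⌝ ⟩ ])} {ψ : Ξ ≅ (Γ [ Δ ])} → InBranch (⊙e-min {Γ = Γ} {d₁} {d₂} {φ} {ψ})
  b-⊗e : ∀ {Δ Θ Ξ A B C} {Γ : HCtx} {d₁ : Deriv Δ (A ⊗ B)} {d₂ : Deriv Θ C}
           {φ : Θ ≅ (Γ [ ⌜ A ⌝ ,, ⌜ B ⌝ ])} {ψ : Ξ ≅ (Γ [ Δ ])} → InBranch (⊗e-min {Γ = Γ} {d₁} {d₂} {φ} {ψ})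
  b-ent : ∀ {Γ Γ' C} {d : Deriv Γ C} {φ : Γ' ⊑ Γ} → InBranch (ent-p {d = d} {φ})

data IsMajorOfElim : ∀ {Γ C} {d : Deriv Γ C} → Prem d → Set where
  m-⧵e : ∀ {Γ Δ Θ A C} {d₁ : Deriv Γ A} {d₂ : Deriv Δ (A ⧵ C)} {φ : Θ ≅ ⟨ Γ ⨾ Δ ⟩} → IsMajorOfElim (⧵e-fun {d₁ = d₁} {d₂} {φ})
  m-╱e : ∀ {Γ Δ Θ A C} {d₁ : Deriv Δ (C ╱ A)} {d₂ : Deriv Γ A} {φ : Θ ≅ ⟨ Δ ⨾ Γ ⟩} → IsMajorOfElim (╱e-fun {d₁ = d₁} {d₂} {φ})
  m-⊸e : ∀ {Γ Δ Θ A C} {d₁ : Deriv Γ A} {d₂ : Deriv Δ (A ⊸ C)} {φ : Θ ≅ (Γ ,, Δ)} → IsMajorOfElim (⊸e-fun {d₁ = d₁} {d₂} {φ})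
  m-⊙e : ∀ {Δ Θ Ξ A B C} {Γ : HCtx} {d₁ : Deriv Δ (A ⊙ B)} {d₂ : Deriv Θ C}
           {φ : Θ ≅ (Γ [ ⟨ ⌜ A ⌝ ⨾ ⌜ B ⌝ ⟩ ])} {ψ : Ξ ≅ (Γ [ Δ ])} → IsMajorOfElim (⊙e-maj {Γ = Γ} {d₁} {d₂} {φ} {ψ})
  m-⊗e : ∀ {Δ Θ Ξ A B C} {Γ : HCtx} {d₁ : Deriv Δ (A ⊗ B)} {d₂ : Deriv Θ C}
           {φ : Θ ≅ (Γ [ ⌜ A ⌝ ,, ⌜ B ⌝ ])} {ψ : Ξ ≅ (Γ [ Δ ])} → IsMajorOfElim (⊗e-maj {Γ = Γ} {d₁} {d₂} {φ} {ψ})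

data IsIntro : SDeriv → Set where
  i-⧵ : ∀ {Γ Θ A C} {φ : Θ ≅ ⟨ ⌜ A ⌝ ⨾ Γ ⟩} {d : Deriv Θ C} → IsIntro (_ , _ , ⧵i φ d)
  i-╱ : ∀ {Γ Θ A C} {φ : Θ ≅ ⟨ Γ ⨾ ⌜ A ⌝ ⟩} {d : Deriv Θ C} → IsIntro (_ , _ , ╱i φ d)
  i-⊸ : ∀ {Γ Θ A C} {φ : Θ ≅ (⌜ A ⌝ ,, Γ)} {d : Deriv Θ C} → IsIntro (_ , _ , ⊸i φ d)
  i-⊙ : ∀ {Γ Δ Θ A B} {d₁ : Deriv Δ A} {d₂ : Deriv Γ B} {φ : Θ ≅ ⟨ Δ ⨾ Γ ⟩} → IsIntro (_ , _ , ⊙i d₁ d₂ φ)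
  i-⊗ : ∀ {Γ Δ Θ A B} {d₁ : Deriv Δ A} {d₂ : Deriv Γ B} {φ : Θ ≅ (Δ ,, Γ)} → IsIntro (_ , _ , ⊗i d₁ d₂ φ)

data IsImplElim : SDeriv → Set where
  e-⧵ : ∀ {Γ Δ Θ A C} {d₁ : Deriv Γ A} {d₂ : Deriv Δ (A ⧵ C)} {φ : Θ ≅ ⟨ Γ ⨾ Δ ⟩} → IsImplElim (_ , _ , ⧵e d₁ d₂ φ)
  e-╱ : ∀ {Γ Δ Θ A C} {d₁ : Deriv Δ (C ╱ A)} {d₂ : Deriv Γ A} {φ : Θ ≅ ⟨ Δ ⨾ Γ ⟩} → IsImplElim (_ , _ , ╱e d₁ d₂ φ)
  e-⊸ : ∀ {Γ Δ Θ A C} {d₁ : Deriv Γ A} {d₂ : Deriv Δ (A ⊸ C)} {φ : Θ ≅ (Γ ,, Δ)} → IsImplElim (_ , _ , ⊸e d₁ d₂ φ)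

data Pos : SDeriv → Set where
  here  : ∀ {s} → Pos s
  there : ∀ {Γ C} {d : Deriv Γ C} (i : Prem d) → Pos (premD i) → Pos (Γ , C , d)

node : ∀ {s} → Pos s → SDeriv
node {s} here = s
node (there i p) = node p

data Step : ∀ {s} → Pos s → Pos s → Set where
  step-here  : ∀ {Γ C} {d : Deriv Γ C} (i : Prem d) → InBranch i →
               Step {Γ , C , d} here (there i here)
  step-there : ∀ {Γ C} {d : Deriv Γ C} (i : Prem d) {p q : Pos (premD i)} →
               Step p q → Step (there i p) (there i q)

data MajorPremise : ∀ {s} → Pos s → Set where
  maj-here  : ∀ {Γ C} {d : Deriv Γ C} (i : Prem d) → IsMajorOfElim i →
              MajorPremise {Γ , C , d} (there i here)
  maj-there : ∀ {Γ C} {d : Deriv Γ C} (i : Prem d) {p : Pos (premD i)} →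
              MajorPremise p → MajorPremise (there i p)

-- S 0, …, S k is a k-extended-redex of the proof π
-- (only the values S 0 … S k matter).
ExtRedex : ∀ {Γ C} (π : Deriv Γ C) (k : ℕ) → (ℕ → Pos (Γ , C , π)) → Set
ExtRedex π k S =
  MajorPremise (S 0) ×
  (∀ t → t < k → Step (S t) (S (suc t))) ×
  IsIntro (node (S k)) ×
  rhs (node (S 0)) ≡ rhs (node (S k))

-- Along the principal branch the right-hand formula can only change at an
-- introduction or at an implication elimination, and the premise of an
-- implication elimination in the branch is a major premise.  So, starting from
-- the major premise S (t + 1) and restarting after every implication
-- elimination met, the right-hand formula is kept until the first
-- introduction, which exists since S k is one.  The extended redex found lies
-- within S (t + 1), …, S k and is therefore shorter than k.
module Submission where

open import Defs
open import Data.Nat using (ℕ; zero; suc; _<_; _≤_; _+_; _∸_; s≤s; z≤n)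
open import Data.Nat.Properties
open import Data.Product using (_×_; ∃; _,_)
open import Relation.Binary.PropositionalEquality

data StepKind {s} (p q : Pos s) : Set where
  introduction           : IsIntro (node p) → StepKind p q
  implicationElimination : IsImplElim (node p) → StepKind p q
  sameRhs                : rhs (node p) ≡ rhs (node q) → StepKind p q

stepKind : ∀ {s} {p q : Pos s} → Step p q → StepKind p q
stepKind (step-there i st) with stepKind st
... | introduction it           = introduction it
... | implicationElimination ie = implicationElimination ie
... | sameRhs eq                = sameRhs eq
stepKind (step-here _ b-⧵e)  = implicationElimination e-⧵
stepKind (step-here _ b-╱e)  = implicationElimination e-╱
stepKind (step-here _ b-⊸e)  = implicationElimination e-⊸
stepKind (step-here _ b-⧵i)  = introduction i-⧵
stepKind (step-here _ b-╱i)  = introduction i-╱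
stepKind (step-here _ b-⊸i)  = introduction i-⊸
stepKind (step-here _ b-⊙e)  = sameRhs refl
stepKind (step-here _ b-⊗e)  = sameRhs refl
stepKind (step-here _ b-ent) = sameRhs refl

implElim-step-majorPremise : ∀ {s} {p q : Pos s} → Step p q →
  IsImplElim (node p) → MajorPremise q
implElim-step-majorPremise (step-there i st) ie = maj-there i (implElim-step-majorPremise st ie)
implElim-step-majorPremise (step-here _ b-⧵e) e-⧵ = maj-here _ m-⧵e
implElim-step-majorPremise (step-here _ b-╱e) e-╱ = maj-here _ m-╱e
implElim-step-majorPremise (step-here _ b-⊸e) e-⊸ = maj-here _ m-⊸e

module _ {Γ C} {π : Deriv Γ C} {k : ℕ} {S : ℕ → Pos (Γ , C , π)}
         (steps : ∀ t → t < k → Step (S t) (S (suc t)))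
         (introₖ : IsIntro (node (S k))) where

  ExtRedexFrom : ℕ → Set
  ExtRedexFrom i = ∃ λ i′ → ∃ λ j′ → i ≤ i′ × i′ ≤ j′ × j′ ≤ k ×
    ExtRedex π (j′ ∸ i′) (λ t → S (i′ + t))

  extRedexFrom-anti : ∀ {i i′} → i ≤ i′ → ExtRedexFrom i′ → ExtRedexFrom i
  extRedexFrom-anti i≤i′ (i″ , j , i′≤i″ , rest) = i″ , j , ≤-trans i≤i′ i′≤i″ , rest

  segment-extRedex : ∀ {i j} → i ≤ j → j ≤ k → MajorPremise (S i) →
    IsIntro (node (S j)) → rhs (node (S i)) ≡ rhs (node (S j)) →
    ExtRedex π (j ∸ i) (λ t → S (i + t))
  segment-extRedex {i} {j} i≤j j≤k maj intro eq =
    at-i maj , shifted-steps , at-j intro , same-rhs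
    where
    i+[j∸i]≡j : i + (j ∸ i) ≡ j
    i+[j∸i]≡j = m+[n∸m]≡n i≤j
    at-i : MajorPremise (S i) → MajorPremise (S (i + 0))
    at-i = subst (λ x → MajorPremise (S x)) (sym (+-identityʳ i))
    at-j : IsIntro (node (S j)) → IsIntro (node (S (i + (j ∸ i))))
    at-j = subst (λ x → IsIntro (node (S x))) (sym i+[j∸i]≡j)
    shifted-steps : ∀ t → t < j ∸ i → Step (S (i + t)) (S (i + suc t))
    shifted-steps t t<j∸i = subst (λ x → Step (S (i + t)) (S x)) (sym (+-suc i t))
      (steps (i + t) (<-≤-trans (subst (i + t <_) i+[j∸i]≡j (+-monoʳ-< i t<j∸i)) j≤k))
    same-rhs : rhs (node (S (i + 0))) ≡ rhs (node (S (i + (j ∸ i))))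
    same-rhs = begin
      rhs (node (S (i + 0)))        ≡⟨ cong (λ x → rhs (node (S x))) (+-identityʳ i) ⟩
      rhs (node (S i))              ≡⟨ eq ⟩
      rhs (node (S j))              ≡⟨ cong (λ x → rhs (node (S x))) i+[j∸i]≡j ⟨
      rhs (node (S (i + (j ∸ i))))  ∎
      where open ≡-Reasoning

  majorPremise⇒extRedexFrom : ∀ d {i j} → j + d ≡ k → i ≤ j → MajorPremise (S i) →
    rhs (node (S i)) ≡ rhs (node (S j)) → ExtRedexFrom i
  majorPremise⇒extRedexFrom zero {i} {j} j+0≡k i≤j maj eq =
    i , j , ≤-refl , i≤j , ≤-reflexive j≡k , segment-extRedex i≤j (≤-reflexive j≡k) maj intro eq
    where
    j≡k : j ≡ k
    j≡k = trans (sym (+-identityʳ j)) j+0≡k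
    intro : IsIntro (node (S j))
    intro = subst (λ x → IsIntro (node (S x))) (sym j≡k) introₖ
  majorPremise⇒extRedexFrom (suc d) {i} {j} j+1+d≡k i≤j maj eq = continue (stepKind (steps j j<k))
    where
    j<k : j < k
    j<k = subst (j <_) j+1+d≡k (m<m+n j (s≤s z≤n))
    1+j+d≡k : suc j + d ≡ k
    1+j+d≡k = trans (sym (+-suc j d)) j+1+d≡k
    continue : StepKind (S j) (S (suc j)) → ExtRedexFrom i
    continue (introduction intro) =
      i , j , ≤-refl , i≤j , <⇒≤ j<k , segment-extRedex i≤j (<⇒≤ j<k) maj intro eq
    continue (implicationElimination ie) =
      extRedexFrom-anti (m≤n⇒m≤1+n i≤j)
        (majorPremise⇒extRedexFrom d 1+j+d≡k ≤-refl (implElim-step-majorPremise (steps j j<k) ie) refl)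
    continue (sameRhs eq′) = majorPremise⇒extRedexFrom d 1+j+d≡k (m≤n⇒m≤1+n i≤j) maj (trans eq eq′)

mainTheorem8 : ∀ {Γ C} (π : Deriv Γ C) (k : ℕ) (S : ℕ → Pos (Γ , C , π)) →
    ExtRedex π k S →
    (∃ λ t → t < k × IsImplElim (node (S t))) →
    ∃ λ i → ∃ λ j → i ≤ j × j ≤ k × (j ∸ i) < k ×
    ExtRedex π (j ∸ i) (λ t → S (i + t))
mainTheorem8 π k S (_ , steps , introₖ , _) (t , t<k , ie)
  with majorPremise⇒extRedexFrom steps introₖ (k ∸ suc t) (m+[n∸m]≡n t<k) ≤-refl
         (implElim-step-majorPremise (steps t t<k) ie) refl
... | i , j , 1+t≤i , i≤j , j≤k , redex =
  i , j , i≤j , j≤k , <-≤-trans (∸-monoʳ-< (≤-trans (s≤s z≤n) 1+t≤i) i≤j) j≤k , redex
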